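{- Let $\mu,\nu,q\in\mathbb{C}$ and let $X,Y$ satisfy $XY-qYX=\mu I+\nu Y$. Define the $q$-deformed Ore-Stirling numbers $S_{\mu,\nu;q}(n;j,k)$ by $(YX)^n=\sum_{j=0}^n\sum_{k=0}^jS_{\mu,\nu;q}(n;j,k)Y^jX^k$. Then for all $n\ge0$ and $0\le k\le j\le n$, $$S_{\mu,\nu;q}(n;j,k)=m_{n-j,j-k}(J_n;q).$$
   Context: The monomials $Y^jX^k$ form a basis of the algebra generated by $X,Y$ with $XY-qYX=\mu I+\nu Y$, so the coefficients are well defined. $J_n$ is the staircase board: top-aligned columns of heights $n-1,n-2,\dots,0$ from left to right. "Above" means in a higher row. For a Ferrers board $B$, $\mathcal{M}_{a,b}(B)$ is the set of placements of $a$ rooks and $b$ files in distinct cells such that no two rooks share a row or column, no two files share a column, no file and rook share a column, and no file lies in the same row as a rook and to its left. For such a placement a cell containing nothing is cancelled if it lies above a rook in its column, or to the left of a rook in its row, or above a file in its column; otherwise it is an empty box. $m_{a,b}(B;q)=\mu^a\nu^b\sum_{\phi\in\mathcal{M}_{a,b}(B)}q^{\#\text{empty boxes of }\phi}$. -}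

module Defs where

open import Data.Nat using (ℕ; zero; suc; _+_; _≡ᵇ_; _<ᵇ_)
open import Data.Bool using (Bool; true; false; _∧_; _∨_; not; if_then_else_)
open import Data.List using (List; []; _∷_; _++_; map; concatMap; length; foldr; upTo; downFrom; zip)
open import Data.Product using (_×_; _,_)
open import Algebra.Bundles using (CommutativeRing)

-- A Ferrers board is given by its list of column heights, left to right;
-- columns are top-aligned.  Column c (0-based from the left) consists of
-- the cells (c , r) with r < height, where the row index r counts from the
-- TOP (r = 0 is the highest row).  So "above" means "smaller row index".
Board : Set
Board = List ℕ

J : ℕ → Board
J n = downFrom n

-- Contents of one column of a placement.  Since no two pieces (rooks or
-- files) may share a column, each column holds at most one piece.
data Choice : Set where
  none : Choice
  rook : ℕ → Choice
  file : ℕ → Choice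

choices : ℕ → List Choice
choices h = none ∷ (map rook (upTo h) ++ map file (upTo h))

placements : Board → List (List Choice)
placements [] = [] ∷ []
placements (h ∷ hs) = concatMap (λ ch → map (ch ∷_) (placements hs)) (choices h)

anyB : {A : Set} → (A → Bool) → List A → Bool
anyB p = foldr (λ x b → p x ∨ b) false

allB : {A : Set} → (A → Bool) → List A → Bool
allB p = foldr (λ x b → p x ∧ b) true

countB : {A : Set} → (A → Bool) → List A → ℕ
countB p = foldr (λ x n → if p x then suc n else n) 0

indexed : List Choice → List (ℕ × Choice)
indexed p = zip (upTo (length p)) p

isRook : Choice → Bool
isRook (rook _) = true
isRook _ = false

isFile : Choice → Bool
isFile (file _) = true
isFile _ = false

rookInRow : ℕ → Choice → Bool
rookInRow r (rook r') = r' ≡ᵇ r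
rookInRow r _ = false

-- two pieces in columns c < c' that violate the rules:
-- two rooks in the same row, or a file in the same row as a rook and to its left
badPair : Choice → Choice → Bool
badPair (rook r) (rook r') = r ≡ᵇ r'
badPair (file r) (rook r') = r ≡ᵇ r'
badPair _ _ = false

valid : List Choice → Bool
valid p = allB (λ { (c , ch) → allB (λ { (c' , ch') → not (c <ᵇ c') ∨ not (badPair ch ch') }) (indexed p) }) (indexed p)

numRooks : List Choice → ℕ
numRooks = countB isRook

numFiles : List Choice → ℕ
numFiles = countB isFile

-- cell (c , r) in a column with contents ch is occupied or cancelled by its
-- own column: it holds the piece, or lies above a rook/file in its column
blockedInColumn : Choice → ℕ → Bool
blockedInColumn none r = false
blockedInColumn (rook r₀) r = r <ᵇ suc r₀
blockedInColumn (file r₀) r = r <ᵇ suc r₀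

rookToRight : List Choice → ℕ → ℕ → Bool
rookToRight p c r = anyB (λ { (c' , ch') → (c <ᵇ c') ∧ rookInRow r ch' }) (indexed p)

emptyBoxes : Board → List Choice → ℕ
emptyBoxes B p = foldr (λ { (c , (h , ch)) n →
    countB (λ r → not (blockedInColumn ch r) ∧ not (rookToRight p c r)) (upTo h) + n })
  0 (zip (upTo (length B)) (zip B p))

inM : ℕ → ℕ → List Choice → Bool
inM a b p = valid p ∧ (numRooks p ≡ᵇ a) ∧ (numFiles p ≡ᵇ b)

module _ {c ℓ} (R : CommutativeRing c ℓ) where
  open CommutativeRing R using (_*_; 1#; 0#) renaming (Carrier to K; _+_ to _⊕_)

  pow : K → ℕ → K
  pow x zero = 1#
  pow x (suc n) = x * pow x n

  sumK : List K → K
  sumK = foldr _⊕_ 0#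

  m : (μ ν q : K) → ℕ → ℕ → Board → K
  m μ ν q a b B = pow μ a * pow ν b *
    sumK (map (λ p → if inM a b p then pow q (emptyBoxes B p) else 0#) (placements B))

  -- The algebra K⟨X,Y⟩ / (XY - qYX - μ - νY), with basis Y^j X^k.
  -- An element is a formal linear combination of normal-ordered monomials,
  -- represented by a list of terms (coefficient , j , k) meaning coeff·Y^j X^k.
  Term : Set c
  Term = K × ℕ × ℕ

  Elem : Set c
  Elem = List Term

  leftY : Elem → Elem
  leftY = map (λ { (a , j , k) → (a , suc j , k) })

  scale : K → Elem → Elem
  scale s = map (λ { (a , j , k) → (s * a , j , k) })

  -- X · (a Y^j X^k), normal ordered using XY = qYX + μ + νY:
  -- X Y^{j+1} X^k = q Y (X Y^j X^k) + μ Y^j X^k + ν Y^{j+1} X^k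
  leftXmono : (μ ν q : K) → K → ℕ → ℕ → Elem
  leftXmono μ ν q a zero k = (a , zero , suc k) ∷ []
  leftXmono μ ν q a (suc j) k =
    leftY (scale q (leftXmono μ ν q a j k)) ++ ((μ * a , j , k) ∷ (ν * a , suc j , k) ∷ [])

  leftX : (μ ν q : K) → Elem → Elem
  leftX μ ν q = concatMap (λ { (a , j , k) → leftXmono μ ν q a j k })

  YXpow : (μ ν q : K) → ℕ → Elem
  YXpow μ ν q zero = (1# , zero , zero) ∷ []
  YXpow μ ν q (suc n) = leftY (leftX μ ν q (YXpow μ ν q n))

  coeff : Elem → ℕ → ℕ → K
  coeff e j k = sumK (map (λ { (a , j' , k') → if (j' ≡ᵇ j) ∧ (k' ≡ᵇ k) then a else 0# }) e)

  S : (μ ν q : K) → ℕ → ℕ → ℕ → K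
  S μ ν q n j k = coeff (YXpow μ ν q n) j k

-- Both sides satisfy f(n+1; 0, k) = 0 and
--   f(n+1; j+1, k) = q^j f(n; j, k-1) + μ [j+1]_q f(n; j+1, k) + ν [j]_q f(n; j, k)
-- (the first term only for k > 0), and they agree for n = 0.  For S this follows from
-- (YX)^(n+1) = Y X (YX)^n and X Y^j = q^j Y^j X + [j]_q (μ Y^(j-1) + ν Y^j).
-- For the rook numbers, J_(n+1) is J_n with a new leftmost column of height n.  If a valid
-- placement on J_n has r rooks, exactly n - r rows of the new column have no rook to their right.
-- Leaving the new column empty makes these n - r cells empty boxes, which gives q^(n-r).  A rook or
-- file placed in one of these rows cancels the cells above it and leaves the free cells below it
-- empty, so summing over the n - r choices gives μ [n-r]_q or ν [n-r]_q.

module Submission where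

open import Defs
open import Algebra.Bundles using (CommutativeRing)
open import Data.Bool using (Bool; true; false; _∧_; _∨_; not; if_then_else_; T)
open import Data.Bool.Properties using (T-∧; T-not-≡; ∧-zeroʳ)
open import Data.List using (List; []; _∷_; _++_; [_]; map; concatMap; length; foldr; upTo; applyUpTo; zip)
open import Data.List.Properties using (map-applyUpTo; map-id; map-∘; zip-map; upTo-∷ʳ; length-upTo; foldr-map; foldr-cong)
open import Data.List.Relation.Unary.All using (All; []; _∷_)
import Data.List.Relation.Unary.All as All
open import Data.List.Relation.Unary.All.Properties using (concat⁺; map⁺; ++⁺; applyUpTo⁺₁)
open import Data.Nat using (ℕ; zero; suc; _+_; _∸_; _≤_; _<_; _≡ᵇ_; _<ᵇ_; z≤n; s≤s)
open import Data.Nat.Properties using (≡ᵇ⇒≡; +-suc; m≤n⇒m≤1+n; m≤n⇒m<n∨m≡n)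
import Data.Nat.Properties as ℕ
open import Data.Product using (_×_; _,_; proj₁; proj₂; map₁; map₂)
open import Data.Sum using (inj₁; inj₂)
open import Data.Unit using (⊤; tt)
open import Data.Empty using (⊥-elim)
open import Relation.Nullary using (¬_)
open import Function using (_∘_; Equivalence)
open import Relation.Binary.PropositionalEquality using (_≡_; refl; sym; trans; cong; cong₂; subst; module ≡-Reasoning)

open Equivalence using (to)

≡ᵇ-sym : ∀ m n → (m ≡ᵇ n) ≡ (n ≡ᵇ m)
≡ᵇ-sym zero    zero    = refl
≡ᵇ-sym zero    (suc n) = refl
≡ᵇ-sym (suc m) zero    = refl
≡ᵇ-sym (suc m) (suc n) = ≡ᵇ-sym m n

≡ᵇ-refl : ∀ n → (n ≡ᵇ n) ≡ true
≡ᵇ-refl zero    = refl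
≡ᵇ-refl (suc n) = ≡ᵇ-refl n

>⇒≡ᵇ-false : ∀ {m n} → n < m → (m ≡ᵇ n) ≡ false
>⇒≡ᵇ-false {suc m} {zero}  _         = refl
>⇒≡ᵇ-false {suc m} {suc n} (s≤s n<m) = >⇒≡ᵇ-false n<m

<⇒≡ᵇ-false : ∀ {m n} → m < n → (m ≡ᵇ n) ≡ false
<⇒≡ᵇ-false {m} {n} m<n = trans (≡ᵇ-sym m n) (>⇒≡ᵇ-false m<n)

<⇒<ᵇ-true : ∀ {m n} → m < n → (m <ᵇ n) ≡ true
<⇒<ᵇ-true {zero}  {suc n} _         = refl
<⇒<ᵇ-true {suc m} {suc n} (s≤s m<n) = <⇒<ᵇ-true m<n

<⇒≮ᵇsuc : ∀ {m n} → m < n → (n <ᵇ suc m) ≡ false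
<⇒≮ᵇsuc {zero}  {suc n} _         = refl
<⇒≮ᵇsuc {suc m} {suc n} (s≤s m<n) = <⇒≮ᵇsuc m<n

j+r≡ᵇn≡r≡ᵇn∸j : ∀ j n r → j ≤ n → ((j + r) ≡ᵇ n) ≡ (r ≡ᵇ n ∸ j)
j+r≡ᵇn≡r≡ᵇn∸j zero    n       r _         = refl
j+r≡ᵇn≡r≡ᵇn∸j (suc j) (suc n) r (s≤s j≤n) = j+r≡ᵇn≡r≡ᵇn∸j j n r j≤n

upTo-< : ∀ n → All (_< n) (upTo n)
upTo-< n = applyUpTo⁺₁ (λ i → i) n (λ i<n → i<n)

T-∧³ : ∀ {a b c} → T (a ∧ b ∧ c) → T a × T b × T c
T-∧³ abc = map₂ (to T-∧) (to T-∧ abc)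

countB-++ : ∀ {A : Set} (h : A → Bool) xs ys → countB h (xs ++ ys) ≡ countB h xs + countB h ys
countB-++ h []       ys = refl
countB-++ h (x ∷ xs) ys with h x
... | true  = cong suc (countB-++ h xs ys)
... | false = countB-++ h xs ys

countB-upTo-suc : ∀ (h : ℕ → Bool) n → countB h (upTo (suc n)) ≡ countB h (upTo n) + (if h n then 1 else 0)
countB-upTo-suc h n = trans (cong (countB h) (sym (upTo-∷ʳ n))) (countB-++ h (upTo n) [ n ])

countB-cong : ∀ {A : Set} {h g : A → Bool} (xs : List A) → (∀ x → h x ≡ g x) → countB h xs ≡ countB g xs
countB-cong []       h≗g = refl
countB-cong (x ∷ xs) h≗g rewrite h≗g x | countB-cong xs h≗g = refl

countB-zero : ∀ {A : Set} {h : A → Bool} {xs} → All (λ x → h x ≡ false) xs → countB h xs ≡ 0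
countB-zero []             = refl
countB-zero (hx≡false ∷ hs) rewrite hx≡false = countB-zero hs

countB-not : ∀ {A : Set} (h : A → Bool) xs → countB (not ∘ h) xs + countB h xs ≡ length xs
countB-not h []       = refl
countB-not h (x ∷ xs) with h x
... | true  = trans (+-suc _ _) (cong suc (countB-not h xs))
... | false = cong suc (countB-not h xs)

countB-∨ : ∀ {A : Set} (g h : A → Bool) → (∀ x → T (g x) → h x ≡ false) → ∀ xs →
  countB (λ x → g x ∨ h x) xs ≡ countB g xs + countB h xs
countB-∨ g h disjoint []       = refl
countB-∨ g h disjoint (x ∷ xs) with g x in gx
... | true  rewrite disjoint x (subst T (sym gx) tt) = cong suc (countB-∨ g h disjoint xs)
... | false with h x
...   | true  = trans (cong suc (countB-∨ g h disjoint xs)) (sym (+-suc _ _))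
...   | false = countB-∨ g h disjoint xs

count-≡ᵇ-upTo : ∀ r n → r < n → countB (r ≡ᵇ_) (upTo n) ≡ 1
count-≡ᵇ-upTo r (suc n) (s≤s r≤n) with m≤n⇒m<n∨m≡n r≤n
... | inj₁ r<n  = trans (countB-upTo-suc (r ≡ᵇ_) n)
  (cong₂ _+_ (count-≡ᵇ-upTo r n r<n) (cong (λ b → if b then 1 else 0) (<⇒≡ᵇ-false r<n)))
... | inj₂ refl = trans (countB-upTo-suc (r ≡ᵇ_) r)
  (cong₂ _+_ (countB-zero (All.map >⇒≡ᵇ-false (upTo-< r))) (cong (λ b → if b then 1 else 0) (≡ᵇ-refl r)))

allB-map : ∀ {A B : Set} (h : B → Bool) (g : A → B) xs → allB h (map g xs) ≡ allB (h ∘ g) xs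
allB-map h g = foldr-map _ g true

anyB-map : ∀ {A B : Set} (h : B → Bool) (g : A → B) xs → anyB h (map g xs) ≡ anyB (h ∘ g) xs
anyB-map h g = foldr-map _ g false

allB-cong : ∀ {A : Set} {h g : A → Bool} (xs : List A) → (∀ x → h x ≡ g x) → allB h xs ≡ allB g xs
allB-cong xs h≗g = foldr-cong (λ x b → cong (_∧ b) (h≗g x)) refl xs

allB-true : ∀ {A : Set} (xs : List A) → allB (λ _ → true) xs ≡ true
allB-true []       = refl
allB-true (x ∷ xs) = allB-true xs

allB-not : ∀ {A : Set} (h : A → Bool) xs → allB (not ∘ h) xs ≡ not (anyB h xs)
allB-not h []       = refl
allB-not h (x ∷ xs) with h x
... | true  = refl
... | false = allB-not h xs

zip-applyUpTo-suc : ∀ {A : Set} n (xs : List A) → zip (applyUpTo suc n) xs ≡ map (map₁ suc) (zip (upTo n) xs)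
zip-applyUpTo-suc n xs = begin
  zip (applyUpTo suc n) xs                  ≡⟨ cong₂ zip (sym (map-applyUpTo (λ i → i) suc n)) (sym (map-id xs)) ⟩
  zip (map suc (upTo n)) (map (λ y → y) xs) ≡⟨ zip-map suc (λ y → y) (upTo n) xs ⟩
  map (map₁ suc) (zip (upTo n) xs)          ∎
  where open ≡-Reasoning

indexed-∷ : ∀ ch p → indexed (ch ∷ p) ≡ (0 , ch) ∷ map (map₁ suc) (indexed p)
indexed-∷ ch p = cong ((0 , ch) ∷_) (zip-applyUpTo-suc (length p) p)

map-proj₂-indexed : ∀ p → map proj₂ (indexed p) ≡ p
map-proj₂-indexed []       = refl
map-proj₂-indexed (ch ∷ p) = trans (cong (map proj₂) (indexed-∷ ch p))
  (cong (ch ∷_) (trans (sym (map-∘ (indexed p))) (map-proj₂-indexed p)))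

allB-indexed : ∀ (h : Choice → Bool) p → allB (h ∘ proj₂) (indexed p) ≡ allB h p
allB-indexed h p = trans (sym (allB-map h proj₂ (indexed p))) (cong (allB h) (map-proj₂-indexed p))

anyB-indexed : ∀ (h : Choice → Bool) p → anyB (h ∘ proj₂) (indexed p) ≡ anyB h p
anyB-indexed h p = trans (sym (anyB-map h proj₂ (indexed p))) (cong (anyB h) (map-proj₂-indexed p))

rowHasRook : List Choice → ℕ → Bool
rowHasRook p r = anyB (rookInRow r) p

freeRow : List Choice → ℕ → Bool
freeRow p r = not (rowHasRook p r)

rookToRight-∷-zero : ∀ ch p r → rookToRight (ch ∷ p) 0 r ≡ rowHasRook p r
rookToRight-∷-zero ch p r = trans (cong (anyB _) (zip-applyUpTo-suc (length p) p))
  (trans (anyB-map _ (map₁ suc) (indexed p)) (anyB-indexed (rookInRow r) p))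

rookToRight-∷-suc : ∀ ch p c r → rookToRight (ch ∷ p) (suc c) r ≡ rookToRight p c r
rookToRight-∷-suc ch p c r = trans (cong (anyB _) (zip-applyUpTo-suc (length p) p))
  (anyB-map _ (map₁ suc) (indexed p))

compatible : Choice → List Choice → Bool
compatible ch p = allB (λ ch′ → not (badPair ch ch′)) p

valid-∷ : ∀ ch p → valid (ch ∷ p) ≡ compatible ch p ∧ valid p
valid-∷ ch p rewrite zip-applyUpTo-suc (length p) p = cong₂ _∧_
  (trans (allB-map _ (map₁ suc) (indexed p)) (allB-indexed (λ ch′ → not (badPair ch ch′)) p))
  (trans (allB-map _ (map₁ suc) (indexed p)) (allB-cong (indexed p) (λ x → allB-map _ (map₁ suc) (indexed p))))

compatible-none : ∀ p → compatible none p ≡ true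
compatible-none = allB-true

compatible-rook : ∀ r p → compatible (rook r) p ≡ freeRow p r
compatible-rook r p = trans (allB-cong p sameRow) (allB-not (rookInRow r) p)
  where
  sameRow : ∀ ch → not (badPair (rook r) ch) ≡ not (rookInRow r ch)
  sameRow none      = refl
  sameRow (rook r′) = cong not (≡ᵇ-sym r r′)
  sameRow (file r′) = refl

compatible-file : ∀ r p → compatible (file r) p ≡ freeRow p r
compatible-file r p = trans (allB-cong p (λ { none → refl ; (rook _) → refl ; (file _) → refl })) (compatible-rook r p)

columnEmptyBoxes : Choice → List Choice → ℕ → ℕ
columnEmptyBoxes ch p h = countB (λ r → not (blockedInColumn ch r) ∧ freeRow p r) (upTo h)

emptyBoxes-∷ : ∀ h hs ch p → emptyBoxes (h ∷ hs) (ch ∷ p) ≡ columnEmptyBoxes ch p h + emptyBoxes hs p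
emptyBoxes-∷ h hs ch p = cong₂ _+_
  (countB-cong (upTo h) (λ r → cong (λ b → not (blockedInColumn ch r) ∧ not b) (rookToRight-∷-zero ch p r)))
  (trans (cong (foldr _ 0) (zip-applyUpTo-suc (length hs) (zip hs p)))
  (trans (foldr-map _ (map₁ suc) 0 (zip (upTo (length hs)) (zip hs p)))
         (foldr-cong (λ { (c , (h′ , ch′)) n → cong (_+ n) (countB-cong (upTo h′)
                            (λ r → cong (λ b → not (blockedInColumn ch′ r) ∧ not b) (rookToRight-∷-suc ch p c r))) })
                     refl (zip (upTo (length hs)) (zip hs p)))))

InRows : ℕ → Choice → Set
InRows n none     = ⊤
InRows n (rook r) = r < n
InRows n (file r) = r < n

InRows-suc : ∀ {n} ch → InRows n ch → InRows (suc n) ch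
InRows-suc none     _   = tt
InRows-suc (rook r) r<n = m≤n⇒m≤1+n r<n
InRows-suc (file r) r<n = m≤n⇒m≤1+n r<n

FitsIn : ℕ → List Choice → Set
FitsIn n p = length p ≡ n × All (InRows n) p

placements-fitIn : ∀ n → All (FitsIn n) (placements (J n))
placements-fitIn zero    = (refl , []) ∷ []
placements-fitIn (suc n) = concat⁺ (map⁺ (All.map (λ ch-ok → map⁺ (extend ch-ok)) firstColumn))
  where
  extend : ∀ {ch} → InRows (suc n) ch → All (λ p → FitsIn (suc n) (ch ∷ p)) (placements (J n))
  extend ch-ok = All.map (λ (len , rows) → cong suc len , ch-ok ∷ All.map (λ {ch} → InRows-suc ch) rows)
                         (placements-fitIn n)
  rows< : All (_< suc n) (upTo n)
  rows< = All.map m≤n⇒m≤1+n (upTo-< n)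
  firstColumn : All (InRows (suc n)) (choices n)
  firstColumn = tt ∷ ++⁺ (map⁺ rows<) (map⁺ rows<)

valid-∷⇒ : ∀ ch p → T (valid (ch ∷ p)) → T (compatible ch p) × T (valid p)
valid-∷⇒ ch p v = to T-∧ (subst T (valid-∷ ch p) v)

countB-rowHasRook : ∀ n p → All (InRows n) p → T (valid p) → countB (rowHasRook p) (upTo n) ≡ numRooks p
countB-rowHasRook n []             []          _ = countB-zero (All.universal (λ _ → refl) (upTo n))
countB-rowHasRook n (none ∷ p)     (_ ∷ rows)  v = countB-rowHasRook n p rows (proj₂ (valid-∷⇒ none p v))
countB-rowHasRook n (file r ∷ p)   (_ ∷ rows)  v = countB-rowHasRook n p rows (proj₂ (valid-∷⇒ (file r) p v))
countB-rowHasRook n (rook r ∷ p)   (r<n ∷ rows) v =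
  trans (countB-∨ (r ≡ᵇ_) (rowHasRook p) onlyRow (upTo n))
        (cong₂ _+_ (count-≡ᵇ-upTo r n r<n) (countB-rowHasRook n p rows (proj₂ (valid-∷⇒ (rook r) p v))))
  where
  onlyRow : ∀ r′ → T (r ≡ᵇ r′) → rowHasRook p r′ ≡ false
  onlyRow r′ r≡r′ rewrite sym (≡ᵇ⇒≡ r r′ r≡r′) =
    to T-not-≡ (subst T (compatible-rook r p) (proj₁ (valid-∷⇒ (rook r) p v)))

freeRows : ℕ → List Choice → ℕ
freeRows n p = countB (freeRow p) (upTo n)

freeRows+numRooks : ∀ n p → All (InRows n) p → T (valid p) → freeRows n p + numRooks p ≡ n
freeRows+numRooks n p rows v = begin
  freeRows n p + numRooks p                          ≡⟨ cong (freeRows n p +_) (sym (countB-rowHasRook n p rows v)) ⟩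
  freeRows n p + countB (rowHasRook p) (upTo n)      ≡⟨ countB-not (rowHasRook p) (upTo n) ⟩
  length (upTo n)                                    ≡⟨ length-upTo n ⟩
  n                                                  ∎
  where open ≡-Reasoning

numFiles+numRooks≤length : ∀ p → numFiles p + numRooks p ≤ length p
numFiles+numRooks≤length []           = z≤n
numFiles+numRooks≤length (none ∷ p)   = m≤n⇒m≤1+n (numFiles+numRooks≤length p)
numFiles+numRooks≤length (rook r ∷ p) = subst (_≤ suc (length p)) (sym (+-suc _ _)) (s≤s (numFiles+numRooks≤length p))
numFiles+numRooks≤length (file r ∷ p) = s≤s (numFiles+numRooks≤length p)

-- Unlike #rooks = n ∸ j and #files = j ∸ k, this guard is exact for all j and k, so the
-- rook numbers it defines satisfy the recurrence with no range conditions.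
counted : ℕ → ℕ → ℕ → List Choice → Bool
counted n j k p = valid p ∧ ((j + numRooks p) ≡ᵇ n) ∧ ((k + numFiles p) ≡ᵇ j)

counted≡inM : ∀ n j k p → k ≤ j → j ≤ n → counted n j k p ≡ inM (n ∸ j) (j ∸ k) p
counted≡inM n j k p k≤j j≤n =
  cong₂ (λ x y → valid p ∧ x ∧ y) (j+r≡ᵇn≡r≡ᵇn∸j j n (numRooks p) j≤n) (j+r≡ᵇn≡r≡ᵇn∸j k j (numFiles p) k≤j)

-- Rows are numbered from the top, so this counts the g-rows strictly below row r.
countAfter : (ℕ → Bool) → ℕ → ℕ → ℕ
countAfter g n r = countB (λ r′ → not (r′ <ᵇ suc r) ∧ g r′) (upTo n)

countAfter-suc : ∀ g n r → r < n → countAfter g (suc n) r ≡ countAfter g n r + (if g n then 1 else 0)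
countAfter-suc g n r r<n = trans (countB-upTo-suc _ n)
  (cong (λ b → countAfter g n r + (if not b ∧ g n then 1 else 0)) (<⇒≮ᵇsuc r<n))

countAfter-last : ∀ g n → countAfter g (suc n) n ≡ 0
countAfter-last g n = countB-zero {h = λ r → not (r <ᵇ suc n) ∧ g r}
  (All.map (λ {r} r<1+n → cong (λ b → not b ∧ g r) (<⇒<ᵇ-true r<1+n)) (upTo-< (suc n)))

module _ {c ℓ} (R : CommutativeRing c ℓ) where

  open CommutativeRing R
    renaming (Carrier to K; _+_ to _⊕_; refl to ≈-refl; sym to ≈-sym; trans to ≈-trans)
  open import Relation.Binary.Reasoning.Setoid setoid
  open import Algebra.Solver.Ring.NaturalCoefficients.Default commutativeSemiring
    using (solve; _:=_; _:+_; _:*_; con)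

  sum : List K → K
  sum = sumK R

  _^_ : K → ℕ → K
  _^_ = pow R

  ≡⇒≈ : ∀ {x y} → x ≡ y → x ≈ y
  ≡⇒≈ refl = ≈-refl

  module _ {a} {A : Set a} where

    sum-++ : ∀ (f : A → K) xs ys → sum (map f (xs ++ ys)) ≈ sum (map f xs) ⊕ sum (map f ys)
    sum-++ f []       ys = ≈-sym (+-identityˡ _)
    sum-++ f (x ∷ xs) ys = ≈-trans (+-congˡ (sum-++ f xs ys)) (≈-sym (+-assoc _ _ _))

    sum-cong : ∀ {f g : A → K} xs → (∀ x → f x ≈ g x) → sum (map f xs) ≈ sum (map g xs)
    sum-cong []       f≈g = ≈-refl
    sum-cong (x ∷ xs) f≈g = +-cong (f≈g x) (sum-cong xs f≈g)

    sum-congAll : ∀ {f g : A → K} {xs} → All (λ x → f x ≈ g x) xs → sum (map f xs) ≈ sum (map g xs)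
    sum-congAll []           = ≈-refl
    sum-congAll (fx≈gx ∷ hs) = +-cong fx≈gx (sum-congAll hs)

    sum-zero : ∀ {f : A → K} xs → (∀ x → f x ≈ 0#) → sum (map f xs) ≈ 0#
    sum-zero []       f≈0 = ≈-refl
    sum-zero (x ∷ xs) f≈0 = ≈-trans (+-cong (f≈0 x) (sum-zero xs f≈0)) (+-identityˡ 0#)

    sum-⊕ : ∀ (f g : A → K) xs → sum (map (λ x → f x ⊕ g x) xs) ≈ sum (map f xs) ⊕ sum (map g xs)
    sum-⊕ f g []       = ≈-sym (+-identityˡ 0#)
    sum-⊕ f g (x ∷ xs) = ≈-trans (+-congˡ (sum-⊕ f g xs))
      (solve 4 (λ a b c d → (a :+ b) :+ (c :+ d) := (a :+ c) :+ (b :+ d)) ≈-refl (f x) (g x) _ _)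

    sum-*ˡ : ∀ s (f : A → K) xs → sum (map (λ x → s * f x) xs) ≈ s * sum (map f xs)
    sum-*ˡ s f []       = ≈-sym (zeroʳ s)
    sum-*ˡ s f (x ∷ xs) = ≈-trans (+-congˡ (sum-*ˡ s f xs)) (≈-sym (distribˡ s _ _))

  sum-map-∘ : ∀ {a b} {A : Set a} {B : Set b} (f : B → K) (g : A → B) xs →
    sum (map f (map g xs)) ≡ sum (map (f ∘ g) xs)
  sum-map-∘ f g xs = cong sum (sym (map-∘ xs))

  sum-concatMap : ∀ {a b} {A : Set a} {B : Set b} (f : B → K) (g : A → List B) xs →
    sum (map f (concatMap g xs)) ≈ sum (map (λ x → sum (map f (g x))) xs)
  sum-concatMap f g []       = ≈-refl
  sum-concatMap f g (x ∷ xs) = ≈-trans (sum-++ f (g x) (concatMap g xs)) (+-congˡ (sum-concatMap f g xs))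

  sum-swap : ∀ {a b} {A : Set a} {B : Set b} (h : A → B → K) xs ys →
    sum (map (λ x → sum (map (h x) ys)) xs) ≈ sum (map (λ y → sum (map (λ x → h x y) xs)) ys)
  sum-swap h []       ys = ≈-sym (sum-zero ys (λ _ → ≈-refl))
  sum-swap h (x ∷ xs) ys = ≈-trans (+-congˡ (sum-swap h xs ys)) (≈-sym (sum-⊕ (h x) _ ys))

  if-cong : ∀ b {x y} → (T b → x ≈ y) → (if b then x else 0#) ≈ (if b then y else 0#)
  if-cong true  x≈y = x≈y tt
  if-cong false x≈y = ≈-refl

  if-zero : ∀ b {x} → (T b → x ≈ 0#) → (if b then x else 0#) ≈ 0#
  if-zero true  x≈0 = x≈0 tt
  if-zero false x≈0 = ≈-refl

  *-if : ∀ b s x → s * (if b then x else 0#) ≈ (if b then s * x else 0#)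
  *-if true  s x = ≈-refl
  *-if false s x = zeroʳ s

  sum-if : ∀ {a} {A : Set a} b (f : A → K) xs → sum (map (λ x → if b then f x else 0#) xs) ≈ (if b then sum (map f xs) else 0#)
  sum-if true  f xs = ≈-refl
  sum-if false f xs = sum-zero xs (λ _ → ≈-refl)

  sum-choices : ∀ (g : Choice → K) n →
    sum (map g (choices n)) ≈ g none ⊕ (sum (map (g ∘ rook) (upTo n)) ⊕ sum (map (g ∘ file) (upTo n)))
  sum-choices g n = +-congˡ (≈-trans (sum-++ g (map rook (upTo n)) (map file (upTo n)))
    (≡⇒≈ (cong₂ _⊕_ (sum-map-∘ g rook (upTo n)) (sum-map-∘ g file (upTo n)))))

  pow-+ : ∀ x m n → x ^ (m + n) ≈ x ^ m * x ^ n
  pow-+ x zero    n = ≈-sym (*-identityˡ _)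
  pow-+ x (suc m) n = ≈-trans (*-congˡ (pow-+ x m n)) (≈-sym (*-assoc _ _ _))

  module _ (μ ν q : K) where

    [_]q : ℕ → K
    [ zero  ]q = 0#
    [ suc m ]q = q * [ m ]q ⊕ 1#

    pow-countAfter-suc : ∀ g n r → r < n → q ^ countAfter g (suc n) r ≈ (if g n then q else 1#) * q ^ countAfter g n r
    pow-countAfter-suc g n r r<n = ≈-trans (≡⇒≈ (cong (q ^_) (countAfter-suc g n r r<n))) (lastRowFactor (g n))
      where
      lastRowFactor : ∀ b → q ^ (countAfter g n r + (if b then 1 else 0)) ≈ (if b then q else 1#) * q ^ countAfter g n r
      lastRowFactor true  = ≈-trans (pow-+ q (countAfter g n r) 1) (≈-trans (*-comm _ _) (*-congʳ (*-identityʳ q)))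
      lastRowFactor false = ≈-trans (≡⇒≈ (cong (q ^_) (ℕ.+-identityʳ (countAfter g n r)))) (≈-sym (*-identityˡ _))

    sum-pow-countAfter : ∀ g n →
      sum (map (λ r → if g r then q ^ countAfter g n r else 0#) (upTo n)) ≈ [ countB g (upTo n) ]q
    sum-pow-countAfter g zero    = ≈-refl
    sum-pow-countAfter g (suc n) = begin
      sum (map (w (suc n)) (upTo (suc n)))
        ≡⟨ cong (sum ∘ map (w (suc n))) (sym (upTo-∷ʳ n)) ⟩
      sum (map (w (suc n)) (upTo n ++ [ n ]))
        ≈⟨ sum-++ (w (suc n)) (upTo n) [ n ] ⟩
      sum (map (w (suc n)) (upTo n)) ⊕ (w (suc n) n ⊕ 0#)
        ≈⟨ +-cong (sum-congAll (All.map w-suc (upTo-< n))) (≈-trans (+-identityʳ _) w-last) ⟩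
      sum (map (λ r → factor * w n r) (upTo n)) ⊕ (if g n then 1# else 0#)
        ≈⟨ +-congʳ (≈-trans (sum-*ˡ factor (w n) (upTo n)) (*-congˡ (sum-pow-countAfter g n))) ⟩
      factor * [ countB g (upTo n) ]q ⊕ (if g n then 1# else 0#)
        ≈⟨ lastRow (g n) ⟩
      [ countB g (upTo n) + (if g n then 1 else 0) ]q
        ≡⟨ cong [_]q (sym (countB-upTo-suc g n)) ⟩
      [ countB g (upTo (suc n)) ]q
        ∎
      where
      w : ℕ → ℕ → K
      w m r = if g r then q ^ countAfter g m r else 0#
      factor : K
      factor = if g n then q else 1#
      w-suc : ∀ {r} → r < n → w (suc n) r ≈ factor * w n r
      w-suc {r} r<n = ≈-trans (if-cong (g r) (λ _ → pow-countAfter-suc g n r r<n)) (≈-sym (*-if (g r) factor _))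
      w-last : w (suc n) n ≈ (if g n then 1# else 0#)
      w-last = if-cong (g n) (λ _ → ≡⇒≈ (cong (q ^_) (countAfter-last g n)))
      lastRow : ∀ b → (if b then q else 1#) * [ countB g (upTo n) ]q ⊕ (if b then 1# else 0#)
                      ≈ [ countB g (upTo n) + (if b then 1 else 0) ]q
      lastRow true  = ≡⇒≈ (cong [_]q (ℕ.+-comm 1 (countB g (upTo n))))
      lastRow false = ≈-trans (+-identityʳ _) (≈-trans (*-identityˡ _) (≡⇒≈ (cong [_]q (sym (ℕ.+-identityʳ (countB g (upTo n)))))))

    Coeffs : Set c
    Coeffs = ℕ → ℕ → K

    qShiftX : Coeffs → Coeffs
    qShiftX f j zero    = 0#
    qShiftX f j (suc k) = q ^ j * f j k

    leftXᶜ : Coeffs → Coeffs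
    leftXᶜ f j k = qShiftX f j k ⊕ (μ * [ suc j ]q * f (suc j) k ⊕ ν * [ j ]q * f j k)

    leftYXᶜ : Coeffs → Coeffs
    leftYXᶜ f zero    k = 0#
    leftYXᶜ f (suc j) k = leftXᶜ f j k

    leftYXᶜ-cong : ∀ {f g : Coeffs} → (∀ j k → f j k ≈ g j k) → ∀ j k → leftYXᶜ f j k ≈ leftYXᶜ g j k
    leftYXᶜ-cong f≈g zero    k       = ≈-refl
    leftYXᶜ-cong f≈g (suc j) zero    = +-congˡ (+-cong (*-congˡ (f≈g _ _)) (*-congˡ (f≈g _ _)))
    leftYXᶜ-cong f≈g (suc j) (suc k) = +-cong (*-congˡ (f≈g _ _)) (+-cong (*-congˡ (f≈g _ _)) (*-congˡ (f≈g _ _)))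

    module _ {a} {A : Set a} (f : A → Coeffs) (xs : List A) where

      private
        Σf : Coeffs
        Σf j k = sum (map (λ x → f x j k) xs)

      sum-qShiftX : ∀ j k → sum (map (λ x → qShiftX (f x) j k) xs) ≈ qShiftX Σf j k
      sum-qShiftX j zero    = sum-zero xs (λ _ → ≈-refl)
      sum-qShiftX j (suc k) = sum-*ˡ (q ^ j) (λ x → f x j k) xs

      sum-leftXᶜ : ∀ j k → sum (map (λ x → leftXᶜ (f x) j k) xs) ≈ leftXᶜ Σf j k
      sum-leftXᶜ j k =
        ≈-trans (sum-⊕ _ _ xs) (+-cong (sum-qShiftX j k)
          (≈-trans (sum-⊕ _ _ xs) (+-cong (sum-*ˡ _ (λ x → f x (suc j) k) xs) (sum-*ˡ _ (λ x → f x j k) xs))))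

      sum-leftYXᶜ : ∀ j k → sum (map (λ x → leftYXᶜ (f x) j k) xs) ≈ leftYXᶜ Σf j k
      sum-leftYXᶜ zero    k = sum-zero xs (λ _ → ≈-refl)
      sum-leftYXᶜ (suc j) k = sum-leftXᶜ j k

    -- coeff R e j k is definitionally sum (map (termCoeff j k) e).
    termCoeff : ℕ → ℕ → Term R → K
    termCoeff j k (a , j′ , k′) = if (j′ ≡ᵇ j) ∧ (k′ ≡ᵇ k) then a else 0#

    termCoeffs : Term R → Coeffs
    termCoeffs t j k = termCoeff j k t

    coeff-leftY-zero : ∀ e k → coeff R (leftY R e) 0 k ≈ 0#
    coeff-leftY-zero e k = ≈-trans (≡⇒≈ (sum-map-∘ (termCoeff 0 k) _ e)) (sum-zero e (λ _ → ≈-refl))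

    coeff-leftY-suc : ∀ e j k → coeff R (leftY R e) (suc j) k ≡ coeff R e j k
    coeff-leftY-suc e j k = sum-map-∘ (termCoeff (suc j) k) _ e

    coeff-scale : ∀ s e j k → coeff R (scale R s e) j k ≈ s * coeff R e j k
    coeff-scale s e j k = begin
      coeff R (scale R s e) j k                       ≡⟨ sum-map-∘ (termCoeff j k) _ e ⟩
      sum (map (λ t → termCoeff j k (scale₁ t)) e)    ≈⟨ sum-cong e (λ (a , _ , _) → ≈-sym (*-if _ s a)) ⟩
      sum (map (λ t → s * termCoeff j k t) e)         ≈⟨ sum-*ˡ s (termCoeff j k) e ⟩
      s * coeff R e j k                               ∎
      where
      scale₁ : Term R → Term R
      scale₁ (a , j′ , k′) = (s * a , j′ , k′)

    qShiftX-termCoeffs : ∀ a j′ k′ j k → qShiftX (termCoeffs (a , j′ , k′)) j k ≈ q ^ j * termCoeff j k (a , j′ , suc k′)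
    qShiftX-termCoeffs a j′ k′ j zero rewrite ∧-zeroʳ (j′ ≡ᵇ j) = ≈-sym (zeroʳ _)
    qShiftX-termCoeffs a j′ k′ j (suc k) = ≈-refl

    coeff-leftXmono : ∀ a j′ k′ j k → coeff R (leftXmono R μ ν q a j′ k′) j k ≈ leftXᶜ (termCoeffs (a , j′ , k′)) j k
    coeff-leftXmono a zero k′ zero k = ≈-trans
      (solve 5 (λ x y m n q → x :+ con 0 := con 1 :* x :+ (m :* (q :* con 0 :+ con 1) :* con 0 :+ n :* con 0 :* y))
             ≈-refl (termCoeff 0 k (a , 0 , suc k′)) (termCoeff 0 k (a , 0 , k′)) μ ν q)
      (+-congʳ (≈-sym (qShiftX-termCoeffs a 0 k′ 0 k)))
    coeff-leftXmono a zero k′ (suc j) k = ≈-trans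
      (solve 3 (λ p m n → con 0 :+ con 0 := p :* con 0 :+ (m :* con 0 :+ n :* con 0)) ≈-refl
             (q ^ suc j) (μ * [ suc (suc j) ]q) (ν * [ suc j ]q))
      (+-congʳ (≈-sym (qShiftX-termCoeffs a 0 k′ (suc j) k)))
    coeff-leftXmono a (suc j′) k′ zero k = begin
      coeff R (leftY R (scale R q E) ++ last2) 0 k
        ≈⟨ sum-++ (termCoeff 0 k) (leftY R (scale R q E)) last2 ⟩
      coeff R (leftY R (scale R q E)) 0 k ⊕ (termCoeff 0 k (μ * a , j′ , k′) ⊕ (0# ⊕ 0#))
        ≈⟨ +-cong (coeff-leftY-zero (scale R q E) k) (+-congʳ (≈-sym (*-if _ μ a))) ⟩
      0# ⊕ (μ * B ⊕ (0# ⊕ 0#))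
        ≈⟨ solve 4 (λ m b q n → con 0 :+ (m :* b :+ (con 0 :+ con 0))
                               := con 1 :* con 0 :+ (m :* (q :* con 0 :+ con 1) :* b :+ n :* con 0 :* con 0))
                 ≈-refl μ B q ν ⟩
      1# * 0# ⊕ (μ * [ 1 ]q * B ⊕ ν * [ 0 ]q * 0#)
        ≈⟨ +-congʳ (≈-sym (qShiftX-termCoeffs a (suc j′) k′ 0 k)) ⟩
      leftXᶜ (termCoeffs (a , suc j′ , k′)) 0 k
        ∎
      where
      E last2 : Elem R
      E = leftXmono R μ ν q a j′ k′
      last2 = (μ * a , j′ , k′) ∷ (ν * a , suc j′ , k′) ∷ []
      B : K
      B = termCoeff 0 k (a , j′ , k′)
    coeff-leftXmono a (suc j′) k′ (suc j) k = begin
      coeff R (leftY R (scale R q E) ++ last2) (suc j) k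
        ≈⟨ sum-++ (termCoeff (suc j) k) (leftY R (scale R q E)) last2 ⟩
      coeff R (leftY R (scale R q E)) (suc j) k ⊕ (termCoeff (suc j) k (μ * a , j′ , k′) ⊕ (termCoeff j k (ν * a , j′ , k′) ⊕ 0#))
        ≈⟨ +-cong (≈-trans (≡⇒≈ (coeff-leftY-suc (scale R q E) j k)) (coeff-scale q E j k))
                  (+-cong (≈-sym (*-if _ μ a)) (+-congʳ (≈-sym (*-if _ ν a)))) ⟩
      q * coeff R E j k ⊕ (μ * A ⊕ (ν * B ⊕ 0#))
        ≈⟨ +-congʳ (*-congˡ (≈-trans (coeff-leftXmono a j′ k′ j k) (+-congʳ (qShiftX-termCoeffs a j′ k′ j k)))) ⟩
      q * (q ^ j * X ⊕ (μ * [ suc j ]q * A ⊕ ν * [ j ]q * B)) ⊕ (μ * A ⊕ (ν * B ⊕ 0#))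
        ≈⟨ solve 9 (λ q p x m i₁ a n i₀ b →
                      q :* (p :* x :+ (m :* i₁ :* a :+ n :* i₀ :* b)) :+ (m :* a :+ (n :* b :+ con 0))
                      := q :* p :* x :+ (m :* (q :* i₁ :+ con 1) :* a :+ n :* (q :* i₀ :+ con 1) :* b))
                 ≈-refl q (q ^ j) X μ [ suc j ]q A ν [ j ]q B ⟩
      q ^ suc j * X ⊕ (μ * [ suc (suc j) ]q * A ⊕ ν * [ suc j ]q * B)
        ≈⟨ +-congʳ (≈-sym (qShiftX-termCoeffs a (suc j′) k′ (suc j) k)) ⟩
      leftXᶜ (termCoeffs (a , suc j′ , k′)) (suc j) k
        ∎
      where
      E last2 : Elem R
      E = leftXmono R μ ν q a j′ k′
      last2 = (μ * a , j′ , k′) ∷ (ν * a , suc j′ , k′) ∷ []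
      X A B : K
      X = termCoeff j k (a , j′ , suc k′)
      A = termCoeff (suc j) k (a , j′ , k′)
      B = termCoeff j k (a , j′ , k′)

    coeff-leftX : ∀ e j k → coeff R (leftX R μ ν q e) j k ≈ leftXᶜ (coeff R e) j k
    coeff-leftX e j k = begin
      coeff R (leftX R μ ν q e) j k
        ≈⟨ sum-concatMap (termCoeff j k) _ e ⟩
      sum (map (λ (a , j′ , k′) → coeff R (leftXmono R μ ν q a j′ k′) j k) e)
        ≈⟨ sum-cong e (λ (a , j′ , k′) → coeff-leftXmono a j′ k′ j k) ⟩
      sum (map (λ t → leftXᶜ (termCoeffs t) j k) e)
        ≈⟨ sum-leftXᶜ termCoeffs e j k ⟩
      leftXᶜ (coeff R e) j k
        ∎

    S-suc : ∀ n j k → S R μ ν q (suc n) j k ≈ leftYXᶜ (S R μ ν q n) j k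
    S-suc n zero    k = coeff-leftY-zero (leftX R μ ν q (YXpow R μ ν q n)) k
    S-suc n (suc j) k = ≈-trans (≡⇒≈ (coeff-leftY-suc (leftX R μ ν q (YXpow R μ ν q n)) j k))
                                (coeff-leftX (YXpow R μ ν q n) j k)

    weight : ℕ → List Choice → K
    weight n p = μ ^ numRooks p * ν ^ numFiles p * q ^ emptyBoxes (J n) p

    rookTerms : ℕ → List Choice → Coeffs
    rookTerms n p j k = if counted n j k p then weight n p else 0#

    rookNumber : ℕ → Coeffs
    rookNumber n j k = sum (map (λ p → rookTerms n p j k) (placements (J n)))

    module _ (n : ℕ) (p : List Choice) where

      private
        rk fl F : ℕ
        rk = numRooks p
        fl = numFiles p
        F  = freeRows n p
        W : K
        W  = weight n p

      emptyColumn : ∀ j k → rookTerms (suc n) (none ∷ p) j k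
                    ≈ (if valid p ∧ ((j + rk) ≡ᵇ suc n) ∧ ((k + fl) ≡ᵇ j) then q ^ F * W else 0#)
      emptyColumn j k = ≈-trans
        (≡⇒≈ (cong₂ (λ v e → if v ∧ ((j + rk) ≡ᵇ suc n) ∧ ((k + fl) ≡ᵇ j) then μ ^ rk * ν ^ fl * q ^ e else 0#)
                    (trans (valid-∷ none p) (cong (_∧ valid p) (compatible-none p)))
                    (emptyBoxes-∷ n (J n) none p)))
        (if-cong (valid p ∧ _) (λ _ → ≈-trans (*-congˡ (pow-+ q F _))
          (solve 4 (λ a b f e → a :* b :* (f :* e) := f :* (a :* b :* e)) ≈-refl (μ ^ rk) (ν ^ fl) (q ^ F) _)))

      private
        pieceTerm : ∀ s m free c C → m ≈ s * (μ ^ rk * ν ^ fl) →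
          (if (free ∧ valid p) ∧ C then m * q ^ (c + emptyBoxes (J n) p) else 0#)
          ≈ (if valid p ∧ C then s * W * (if free then q ^ c else 0#) else 0#)
        pieceTerm s m true  c C m≈ = if-cong (valid p ∧ C) (λ _ → ≈-trans (*-cong m≈ (pow-+ q c _))
          (solve 5 (λ s a b x e → s :* (a :* b) :* (x :* e) := s :* (a :* b :* e) :* x) ≈-refl s (μ ^ rk) (ν ^ fl) (q ^ c) _))
        pieceTerm s m false c C m≈ = ≈-sym (if-zero (valid p ∧ C) (λ _ → zeroʳ _))

        pieceColumn : ∀ s (piece : ℕ → Choice) j k C →
          (∀ r → rookTerms (suc n) (piece r ∷ p) j k
                 ≈ (if valid p ∧ C then s * W * (if freeRow p r then q ^ countAfter (freeRow p) n r else 0#) else 0#)) →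
          sum (map (λ r → rookTerms (suc n) (piece r ∷ p) j k) (upTo n)) ≈ (if valid p ∧ C then s * [ F ]q * W else 0#)
        pieceColumn s piece j k C term = begin
          sum (map (λ r → rookTerms (suc n) (piece r ∷ p) j k) (upTo n))
            ≈⟨ sum-cong (upTo n) term ⟩
          sum (map (λ r → if valid p ∧ C then s * W * φ r else 0#) (upTo n))
            ≈⟨ sum-if (valid p ∧ C) _ (upTo n) ⟩
          (if valid p ∧ C then sum (map (λ r → s * W * φ r) (upTo n)) else 0#)
            ≈⟨ if-cong (valid p ∧ C) (λ _ → ≈-trans (sum-*ˡ (s * W) φ (upTo n)) (*-congˡ (sum-pow-countAfter (freeRow p) n))) ⟩
          (if valid p ∧ C then s * W * [ F ]q else 0#)
            ≈⟨ if-cong (valid p ∧ C) (λ _ → solve 3 (λ s w f → s :* w :* f := s :* f :* w) ≈-refl s W [ F ]q) ⟩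
          (if valid p ∧ C then s * [ F ]q * W else 0#)
            ∎
          where
          φ : ℕ → K
          φ r = if freeRow p r then q ^ countAfter (freeRow p) n r else 0#

      rookColumn : ∀ j k → sum (map (λ r → rookTerms (suc n) (rook r ∷ p) j k) (upTo n))
                   ≈ (if valid p ∧ ((j + suc rk) ≡ᵇ suc n) ∧ ((k + fl) ≡ᵇ j) then μ * [ F ]q * W else 0#)
      rookColumn j k = pieceColumn μ rook j k _ λ r → ≈-trans
        (≡⇒≈ (cong₂ (λ v e → if v ∧ ((j + suc rk) ≡ᵇ suc n) ∧ ((k + fl) ≡ᵇ j) then μ ^ suc rk * ν ^ fl * q ^ e else 0#)
                    (trans (valid-∷ (rook r) p) (cong (_∧ valid p) (compatible-rook r p)))
                    (emptyBoxes-∷ n (J n) (rook r) p)))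
        (pieceTerm μ _ (freeRow p r) (countAfter (freeRow p) n r) _ (*-assoc μ _ _))

      fileColumn : ∀ j k → sum (map (λ r → rookTerms (suc n) (file r ∷ p) j k) (upTo n))
                   ≈ (if valid p ∧ ((j + rk) ≡ᵇ suc n) ∧ ((k + suc fl) ≡ᵇ j) then ν * [ F ]q * W else 0#)
      fileColumn j k = pieceColumn ν file j k _ λ r → ≈-trans
        (≡⇒≈ (cong₂ (λ v e → if v ∧ ((j + rk) ≡ᵇ suc n) ∧ ((k + suc fl) ≡ᵇ j) then μ ^ rk * ν ^ suc fl * q ^ e else 0#)
                    (trans (valid-∷ (file r) p) (cong (_∧ valid p) (compatible-file r p)))
                    (emptyBoxes-∷ n (J n) (file r) p)))
        (pieceTerm ν _ (freeRow p r) (countAfter (freeRow p) n r) _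
          (solve 3 (λ a n b → a :* (n :* b) := n :* (a :* b)) ≈-refl (μ ^ rk) ν (ν ^ fl)))

      module _ (fits : FitsIn n p) where

        private
          F+rk≡n : T (valid p) → F + rk ≡ n
          F+rk≡n = freeRows+numRooks n p (proj₂ fits)

          counted⇒freeRows≡ : ∀ j X → T (valid p ∧ ((j + rk) ≡ᵇ n) ∧ X) → F ≡ j
          counted⇒freeRows≡ j X g with T-∧³ {valid p} g
          ... | v , j+rk≡n , _ = ℕ.+-cancelʳ-≡ rk F j (trans (F+rk≡n v) (sym (≡ᵇ⇒≡ _ _ j+rk≡n)))

          tooManyRooks : ∀ X → ¬ T (valid p ∧ (rk ≡ᵇ suc n) ∧ X)
          tooManyRooks X g with T-∧³ {valid p} g
          ... | v , rk≡1+n , _ = ℕ.n≮n n (subst (suc n ≤_)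
                (trans (cong (F +_) (sym (≡ᵇ⇒≡ rk (suc n) rk≡1+n))) (F+rk≡n v)) (ℕ.m≤n+m (suc n) F))

          tooManyFiles : ∀ j → ¬ T (valid p ∧ ((j + rk) ≡ᵇ n) ∧ (fl ≡ᵇ suc j))
          tooManyFiles j g with T-∧³ {valid p} g
          ... | _ , j+rk≡n , fl≡1+j = ℕ.n≮n j (subst (_≤ j) (≡ᵇ⇒≡ fl (suc j) fl≡1+j)
                (ℕ.+-cancelʳ-≤ rk fl j (subst (fl + rk ≤_) (trans (proj₁ fits) (sym (≡ᵇ⇒≡ _ _ j+rk≡n)))
                                                (numFiles+numRooks≤length p))))

        emptyColumn-suc : ∀ j k → rookTerms (suc n) (none ∷ p) (suc j) k ≈ qShiftX (rookTerms n p) j k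
        emptyColumn-suc j zero    = ≈-trans (emptyColumn (suc j) 0) (if-zero _ (⊥-elim ∘ tooManyFiles j))
        emptyColumn-suc j (suc k) = ≈-trans (emptyColumn (suc j) (suc k))
          (≈-trans (if-cong _ (λ g → *-congʳ (≡⇒≈ (cong (q ^_) (counted⇒freeRows≡ j _ g))))) (≈-sym (*-if _ (q ^ j) W)))

        rookColumn-suc : ∀ j k → sum (map (λ r → rookTerms (suc n) (rook r ∷ p) (suc j) k) (upTo n))
                         ≈ μ * [ suc j ]q * rookTerms n p (suc j) k
        rookColumn-suc j k = ≈-trans (rookColumn (suc j) k)
          (≈-trans (≡⇒≈ (cong (λ x → if valid p ∧ (x ≡ᵇ n) ∧ ((k + fl) ≡ᵇ suc j) then μ * [ F ]q * W else 0#) (+-suc j rk)))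
          (≈-trans (if-cong _ (λ g → *-congʳ (*-congˡ (≡⇒≈ (cong [_]q (counted⇒freeRows≡ (suc j) _ g))))))
                   (≈-sym (*-if _ (μ * [ suc j ]q) W))))

        fileColumn-suc : ∀ j k → sum (map (λ r → rookTerms (suc n) (file r ∷ p) (suc j) k) (upTo n))
                         ≈ ν * [ j ]q * rookTerms n p j k
        fileColumn-suc j k = ≈-trans (fileColumn (suc j) k)
          (≈-trans (≡⇒≈ (cong (λ x → if valid p ∧ ((j + rk) ≡ᵇ n) ∧ (x ≡ᵇ suc j) then ν * [ F ]q * W else 0#) (+-suc k fl)))
          (≈-trans (if-cong _ (λ g → *-congʳ (*-congˡ (≡⇒≈ (cong [_]q (counted⇒freeRows≡ j _ g))))))
                   (≈-sym (*-if _ (ν * [ j ]q) W))))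

        newColumn : ∀ j k → sum (map (λ ch → rookTerms (suc n) (ch ∷ p) j k) (choices n)) ≈ leftYXᶜ (rookTerms n p) j k
        newColumn zero k = ≈-trans (sum-choices _ n) (≈-trans (+-cong empty (+-cong rooks files))
                                   (≈-trans (+-identityˡ _) (+-identityˡ 0#)))
          where
          empty : rookTerms (suc n) (none ∷ p) 0 k ≈ 0#
          empty = ≈-trans (emptyColumn 0 k) (if-zero _ (⊥-elim ∘ tooManyRooks _))
          rooks : sum (map (λ r → rookTerms (suc n) (rook r ∷ p) 0 k) (upTo n)) ≈ 0#
          rooks = ≈-trans (rookColumn 0 k) (if-zero _ (λ g →
            ≈-trans (*-congʳ (*-congˡ (≡⇒≈ (cong [_]q (counted⇒freeRows≡ 0 _ g))))) (≈-trans (*-congʳ (zeroʳ μ)) (zeroˡ W))))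
          files : sum (map (λ r → rookTerms (suc n) (file r ∷ p) 0 k) (upTo n)) ≈ 0#
          files = ≈-trans (fileColumn 0 k) (if-zero _ (⊥-elim ∘ tooManyRooks _))
        newColumn (suc j) k = ≈-trans (sum-choices _ n)
          (+-cong (emptyColumn-suc j k) (+-cong (rookColumn-suc j k) (fileColumn-suc j k)))

    rookNumber-suc : ∀ n j k → rookNumber (suc n) j k ≈ leftYXᶜ (rookNumber n) j k
    rookNumber-suc n j k = begin
      sum (map (λ p → rookTerms (suc n) p j k) (concatMap (λ ch → map (ch ∷_) P) (choices n)))
        ≈⟨ sum-concatMap (λ p → rookTerms (suc n) p j k) (λ ch → map (ch ∷_) P) (choices n) ⟩
      sum (map (λ ch → sum (map (λ p → rookTerms (suc n) p j k) (map (ch ∷_) P))) (choices n))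
        ≈⟨ sum-cong (choices n) (λ ch → ≡⇒≈ (sum-map-∘ _ (ch ∷_) P)) ⟩
      sum (map (λ ch → sum (map (λ p → rookTerms (suc n) (ch ∷ p) j k) P)) (choices n))
        ≈⟨ sum-swap _ (choices n) P ⟩
      sum (map (λ p → sum (map (λ ch → rookTerms (suc n) (ch ∷ p) j k) (choices n))) P)
        ≈⟨ sum-congAll (All.map (λ {p} fits → newColumn n p fits j k) (placements-fitIn n)) ⟩
      sum (map (λ p → leftYXᶜ (rookTerms n p) j k) P)
        ≈⟨ sum-leftYXᶜ (rookTerms n) P j k ⟩
      leftYXᶜ (rookNumber n) j k
        ∎
      where
      P : List (List Choice)
      P = placements (J n)

    S≈rookNumber : ∀ n j k → S R μ ν q n j k ≈ rookNumber n j k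
    S≈rookNumber zero    zero    zero    = +-congʳ (≈-sym (≈-trans (*-identityʳ _) (*-identityˡ 1#)))
    S≈rookNumber zero    zero    (suc k) = ≈-refl
    S≈rookNumber zero    (suc j) k       = ≈-refl
    S≈rookNumber (suc n) j       k       =
      ≈-trans (S-suc n j k) (≈-trans (leftYXᶜ-cong (S≈rookNumber n) j k) (≈-sym (rookNumber-suc n j k)))

    rookNumber≈m : ∀ n j k → k ≤ j → j ≤ n → rookNumber n j k ≈ m R μ ν q (n ∸ j) (j ∸ k) (J n)
    rookNumber≈m n j k k≤j j≤n =
      ≈-trans (sum-cong (placements (J n)) term) (sum-*ˡ (μ ^ a * ν ^ b) _ (placements (J n)))
      where
      a b : ℕ
      a = n ∸ j
      b = j ∸ k
      term : ∀ p → rookTerms n p j k ≈ μ ^ a * ν ^ b * (if inM a b p then q ^ emptyBoxes (J n) p else 0#)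
      term p = ≈-trans (≡⇒≈ (cong (λ c → if c then weight n p else 0#) (counted≡inM n j k p k≤j j≤n)))
        (≈-trans (if-cong (inM a b p) (λ g → *-congʳ (*-cong (≡⇒≈ (cong (μ ^_) (rk≡a g))) (≡⇒≈ (cong (ν ^_) (fl≡b g))))))
                 (≈-sym (*-if (inM a b p) (μ ^ a * ν ^ b) (q ^ emptyBoxes (J n) p))))
        where
        rk≡a : T (inM a b p) → numRooks p ≡ a
        rk≡a g = ≡ᵇ⇒≡ _ _ (proj₁ (proj₂ (T-∧³ {valid p} g)))
        fl≡b : T (inM a b p) → numFiles p ≡ b
        fl≡b g = ≡ᵇ⇒≡ _ _ (proj₂ (proj₂ (T-∧³ {valid p} g)))

proposition2p11 : ∀ {c ℓ} (R : CommutativeRing c ℓ) (μ ν q : CommutativeRing.Carrier R)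
                    (n j k : ℕ) → k ≤ j → j ≤ n →
                    CommutativeRing._≈_ R (S R μ ν q n j k) (m R μ ν q (n ∸ j) (j ∸ k) (J n))
proposition2p11 R μ ν q n j k k≤j j≤n =
  CommutativeRing.trans R (S≈rookNumber R μ ν q n j k) (rookNumber≈m R μ ν q n j k k≤j j≤n)
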